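{- Let $P$ be an instance of the Generalized Minimum Manhattan Network problem and let $N^*\in\mathrm{Opt}(P)$. If the intersection graph $\mathrm{IG}[P]$ is $k$-colorable, then every $N\in\mathrm{Feas}(P)$ satisfies $\|N\|\le k\cdot\|N^*\|$.
   Context: A Manhattan path (M-path) for $(s,t)$ is an $s$–$t$ path of axis-aligned segments of total length $|s_x-t_x|+|s_y-t_y|$. The Hanan grid $\mathcal{H}(P)$ is the grid network whose vertex set is $X\times Y$, where $X$ (resp. $Y$) is the set of all $x$- (resp. $y$-) coordinates of points appearing in pairs of $P$, with edges joining consecutive grid vertices. $\Pi_P(v)$ is the set of M-paths for $v$ that are subgraphs of $\mathcal{H}(P)$. $\mathrm{Feas}(P)=\prod_{v\in P}\Pi_P(v)$; a tuple $(\pi_v)_{v\in P}$ is identified with the network $\bigcup_{v}\pi_v$ (union of vertex and edge sets), and $\|N\|$ is its total edge length. $\mathrm{Opt}(P)$ is the set of $N\in\mathrm{Feas}(P)$ minimizing $\|N\|$. The bounding box $B(v)$ of $v=(p,q)$ is the axis-parallel rectangle with corners $p,q$; $\mathcal{H}(P,v)$ is the subgraph of $\mathcal{H}(P)$ induced by grid vertices in $B(v)$; $\mathrm{IG}[P]$ has vertex set $P$ with $u\ne v$ adjacent iff $\mathcal{H}(P,u),\mathcal{H}(P,v)$ share an edge.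
   Formalization: The points appearing in the pairs of the instance P have rational coordinates. -}

module Defs where

open import Data.Nat as ℕ using (ℕ)
open import Data.Integer as ℤ using (+_)
open import Data.Rational as ℚ using (ℚ; 0ℚ; _+_; _-_; _*_; _≤_; _<_; ∣_∣; _/_)
open import Data.Rational.Properties using () renaming (_≟_ to _≟ℚ_)
open import Data.Product using (_×_; _,_; proj₁; proj₂; Σ; ∃; ∃-syntax)
open import Data.Product.Properties using (≡-dec)
open import Data.Sum using (_⊎_)
open import Data.List using (List; []; _∷_; _++_; foldr; deduplicate; length; lookup; concatMap)
open import Data.List.Membership.Propositional using (_∈_)
open import Data.List.Relation.Unary.All using (All; []; _∷_)
open import Data.Fin using (Fin)
open import Relation.Nullary using (¬_)
open import Relation.Nullary.Decidable using (yes; no)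
open import Relation.Binary.PropositionalEquality using (_≡_; _≢_)
open import Relation.Binary.Definitions using (DecidableEquality)

Point : Set
Point = ℚ × ℚ

px py : Point → ℚ
px = proj₁
py = proj₂

Pair : Set
Pair = Point × Point

-- a GMMN instance: a finite set of pairs (list without duplicates,
-- the "no duplicates" condition is imposed in the theorem)
Instance : Set
Instance = List Pair

dist : Point → Point → ℚ
dist s t = ∣ px s - px t ∣ + ∣ py s - py t ∣

Xs : Instance → List ℚ
Xs = concatMap (λ v → px (proj₁ v) ∷ px (proj₂ v) ∷ [])

Ys : Instance → List ℚ
Ys = concatMap (λ v → py (proj₁ v) ∷ py (proj₂ v) ∷ [])

GridVertex : Instance → Point → Set
GridVertex P u = px u ∈ Xs P × py u ∈ Ys P

-- oriented Hanan grid edge u → w joining consecutive grid vertices,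
-- with w to the right of / above u
HEdge : Instance → Point → Point → Set
HEdge P u w =
  GridVertex P u × GridVertex P w ×
  ( (py u ≡ py w × px u < px w ×
       (∀ c → c ∈ Xs P → ¬ (px u < c × c < px w)))
  ⊎ (px u ≡ px w × py u < py w ×
       (∀ c → c ∈ Ys P → ¬ (py u < c × c < py w))) )

Adj : Instance → Point → Point → Set
Adj P u w = HEdge P u w ⊎ HEdge P w u

-- Edges as normalised (unordered) pairs of endpoints

Edge : Set
Edge = Point × Point

_≟P_ : DecidableEquality Point
_≟P_ = ≡-dec _≟ℚ_ _≟ℚ_

_≟E_ : DecidableEquality Edge
_≟E_ = ≡-dec _≟P_ _≟P_

normEdge : Point → Point → Edge
normEdge u w with px u ≟ℚ px w
... | no _ with px u ℚ.≤? px w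
...   | yes _ = u , w
...   | no _ = w , u
normEdge u w | yes _ with py u ℚ.≤? py w
...   | yes _ = u , w
...   | no _ = w , u

edgeLength : Edge → ℚ
edgeLength (u , w) = dist u w

sumℚ : List ℚ → ℚ
sumℚ = foldr _+_ 0ℚ

data Walk (P : Instance) : Point → Point → Set where
  done : ∀ {u} → Walk P u u
  step : ∀ {u w t} → Adj P u w → Walk P w t → Walk P u t

walkEdges : ∀ {P s t} → Walk P s t → List Edge
walkEdges done = []
walkEdges (step {u} {w} _ ws) = normEdge u w ∷ walkEdges ws

walkLength : ∀ {P s t} → Walk P s t → ℚ
walkLength ws = sumℚ (Data.List.map edgeLength (walkEdges ws))

-- Π_P(v): M-paths for v = (s , t) that are subgraphs of H(P)
Π : Instance → Pair → Set
Π P (s , t) = Σ (Walk P s t) (λ π → walkLength π ≡ dist s t)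

Feas : Instance → Set
Feas P = All (Π P) P

feasEdges : ∀ {P Q} → All (Π P) Q → List Edge
feasEdges [] = []
feasEdges ((π , _) ∷ ns) = walkEdges π ++ feasEdges ns

‖_‖ : ∀ {P} → Feas P → ℚ
‖ N ‖ = sumℚ (Data.List.map edgeLength (deduplicate _≟E_ (feasEdges N)))

IsOpt : (P : Instance) → Feas P → Set
IsOpt P N* = (N : Feas P) → ‖ N* ‖ ≤ ‖ N ‖

Between : ℚ → ℚ → ℚ → Set
Between a b c = (a ≤ c × c ≤ b) ⊎ (b ≤ c × c ≤ a)

InBox : Pair → Point → Set
InBox (p , q) z = Between (px p) (px q) (px z) × Between (py p) (py q) (py z)

ShareEdge : Instance → Pair → Pair → Set
ShareEdge P u v =
  ∃[ a ] ∃[ b ] (HEdge P a b × InBox u a × InBox u b × InBox v a × InBox v b)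

IGAdj : (P : Instance) → Fin (length P) → Fin (length P) → Set
IGAdj P i j = i ≢ j × ShareEdge P (lookup P i) (lookup P j)

Colorable : (P : Instance) → ℕ → Set
Colorable P k =
  Σ (Fin (length P) → Fin k)
    (λ c → ∀ (i j : Fin (length P)) → IGAdj P i j → c i ≢ c j)

ℕtoℚ : ℕ → ℚ
ℕtoℚ k = (+ k) / 1

-- An M-path is a geodesic of the L1 metric: along it the distance from its
-- source strictly increases and every vertex stays in the bounding box of its
-- pair. Hence an M-path never repeats an edge, and if two pairs receive the
-- same colour their M-paths in N* are edge-disjoint (a common edge would lie
-- in both grids H(P,u) and H(P,v), making u and v adjacent in IG[P]). So for
-- each colour class the sum of d(v) = |s_v - t_v|_1 is at most ‖N*‖, and
-- summing over the k classes gives Σ_v d(v) ≤ k ‖N*‖. Finally every feasible N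
-- consists of M-paths, so ‖N‖ ≤ Σ_v d(v).
module Submission where

open import Defs
open import Data.Nat using (ℕ)
open import Data.List.Relation.Unary.Unique.Propositional using (Unique)
open import Data.Rational using (_≤_; _*_)

open import Data.Empty using (⊥-elim)
open import Data.Fin using (Fin; toℕ)
open import Data.Fin.Properties using (toℕ-injective; toℕ<n)
import Data.Integer as ℤ
import Data.Integer.Properties as ℤ
open import Data.List
  using (List; []; _∷_; _++_; map; filter; deduplicate; concatMap; lookup; length; allFin; tabulate)
open import Data.List.Properties using (map-tabulate; tabulate-lookup)
open import Data.List.Membership.Propositional using (_∈_)
open import Data.List.Membership.Propositional.Properties
  using (∈-++⁺ˡ; ∈-++⁺ʳ; ∈-filter⁻; ∈-lookup; ∈-concatMap⁻; ∈-deduplicate⁺; ∈-deduplicate⁻)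
open import Data.List.Relation.Binary.Disjoint.Propositional using (Disjoint)
open import Data.List.Relation.Binary.Subset.Propositional using (_⊆_)
open import Data.List.Relation.Unary.All as All using (All; []; _∷_)
import Data.List.Relation.Unary.All.Properties as Allₚ
open import Data.List.Relation.Unary.AllPairs using (AllPairs; []; _∷_)
import Data.List.Relation.Unary.AllPairs.Properties as AllPairsₚ
open import Data.List.Relation.Unary.Any using (here; there; satisfied)
import Data.List.Relation.Unary.Unique.Propositional.Properties as Uniqueₚ
open import Data.List.Relation.Unary.Unique.DecPropositional.Properties _≟E_ using (deduplicate-!)
open import Data.Nat as ℕ using (zero; suc)
import Data.Nat.Properties as ℕ
open import Data.Nat.Coprimality using (1-coprimeTo) renaming (sym to coprime-sym)
open import Data.Product using (_×_; _,_; proj₁; proj₂; ∃₂)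
open import Data.Rational as ℚ using (ℚ; 0ℚ; 1ℚ; _+_; _-_; -_; ∣_∣; _<_; mkℚ)
open import Data.Rational.Properties
open import Data.Rational.Solver using (module +-*-Solver)
open import Data.Rational.Unnormalised.Base using (*≡*)
import Data.Rational.Unnormalised.Properties as ℚᵘ
open import Data.Sum using (_⊎_; inj₁; inj₂)
open import Data.Unit using (⊤)
open import Function using (_∘_; id)
open import Relation.Binary.Definitions using (DecidableEquality)
open import Relation.Binary.PropositionalEquality
open import Relation.Nullary using (Dec; ¬?)
open import Relation.Nullary.Decidable using (yes; no)

open +-*-Solver

p≤∣p∣ : ∀ p → p ≤ ∣ p ∣
p≤∣p∣ p with ∣p∣≡p∨∣p∣≡-p p
... | inj₁ ∣p∣≡p  = ≤-reflexive (sym ∣p∣≡p)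
... | inj₂ ∣p∣≡-p = ≤-trans p≤0 (0≤∣p∣ p)
  where
  p≤0 : p ≤ 0ℚ
  p≤0 = subst₂ _≤_ (solve 1 (λ p → :- (:- p) := p) refl p) refl
          (neg-antimono-≤ (subst (0ℚ ≤_) ∣p∣≡-p (0≤∣p∣ p)))

-p≤∣p∣ : ∀ p → - p ≤ ∣ p ∣
-p≤∣p∣ p = subst (- p ≤_) (∣-p∣≡∣p∣ p) (p≤∣p∣ (- p))

∣p-q∣≡∣q-p∣ : ∀ p q → ∣ p - q ∣ ≡ ∣ q - p ∣
∣p-q∣≡∣q-p∣ p q = trans (cong ∣_∣ (solve 2 (λ p q → p :- q := :- (q :- p)) refl p q)) (∣-p∣≡∣p∣ (q - p))

∣p-r∣≤∣p-q∣+∣q-r∣ : ∀ p q r → ∣ p - r ∣ ≤ ∣ p - q ∣ + ∣ q - r ∣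
∣p-r∣≤∣p-q∣+∣q-r∣ p q r = subst (λ x → ∣ x ∣ ≤ ∣ p - q ∣ + ∣ q - r ∣)
  (solve 3 (λ p q r → (p :- q) :+ (q :- r) := p :- r) refl p q r)
  (∣p+q∣≤∣p∣+∣q∣ (p - q) (q - r))

p≤q⇒p-q≤0 : ∀ {p q} → p ≤ q → p - q ≤ 0ℚ
p≤q⇒p-q≤0 {p} {q} p≤q = subst (p - q ≤_) (+-inverseʳ q) (+-monoˡ-≤ (- q) p≤q)

p<q⇒0<q-p : ∀ {p q} → p < q → 0ℚ < q - p
p<q⇒0<q-p {p} {q} p<q = subst (_< q - p) (+-inverseʳ p) (+-monoˡ-< (- p) p<q)

p≤q⇒0≤q-p : ∀ {p q} → p ≤ q → 0ℚ ≤ q - p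
p≤q⇒0≤q-p {p} {q} p≤q = subst (_≤ q - p) (+-inverseʳ p) (+-monoˡ-≤ (- p) p≤q)

p≤q⇒∣p-q∣≡q-p : ∀ {p q} → p ≤ q → ∣ p - q ∣ ≡ q - p
p≤q⇒∣p-q∣≡q-p {p} {q} p≤q = trans (∣p-q∣≡∣q-p∣ p q) (0≤p⇒∣p∣≡p (p≤q⇒0≤q-p p≤q))

p<q⇒0<∣p-q∣ : ∀ {p q} → p < q → 0ℚ < ∣ p - q ∣
p<q⇒0<∣p-q∣ p<q = subst (0ℚ <_) (sym (p≤q⇒∣p-q∣≡q-p (<⇒≤ p<q))) (p<q⇒0<q-p p<q)

[p-q]+[p-q]≤0⇒p≤q : ∀ {p q} → (p - q) + (p - q) ≤ 0ℚ → p ≤ q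
[p-q]+[p-q]≤0⇒p≤q {p} {q} h with p ≤? q
... | yes p≤q = p≤q
... | no  p≰q = ⊥-elim (<-irrefl refl (<-≤-trans (+-mono-< 0<p-q 0<p-q) h))
  where
  0<p-q : 0ℚ < p - q
  0<p-q = p<q⇒0<q-p (≰⇒> p≰q)

p+q≤r+s∧s≤q⇒p≤r : ∀ {p q r s} → p + q ≤ r + s → s ≤ q → p ≤ r
p+q≤r+s∧s≤q⇒p≤r {p} {q} {r} {s} h s≤q =
  subst₂ _≤_ (cancel p) (cancel r) (+-monoˡ-≤ (- q) (≤-trans h (+-monoʳ-≤ r s≤q)))
  where
  cancel : ∀ x → (x + q) - q ≡ x
  cancel x = solve 2 (λ x q → (x :+ q) :- q := x) refl x q

p+q≤r+s∧r≤p∧s≤q⇒p≤r∧q≤s : ∀ {p q r s} → p + q ≤ r + s → r ≤ p → s ≤ q → p ≤ r × q ≤ s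
p+q≤r+s∧r≤p∧s≤q⇒p≤r∧q≤s {p} {q} {r} {s} h r≤p s≤q =
  p+q≤r+s∧s≤q⇒p≤r h s≤q ,
  p+q≤r+s∧s≤q⇒p≤r (subst₂ _≤_ (+-comm p q) (+-comm r s) h) r≤p

tight⇒between-≤ : ∀ {s t a} → ∣ s - a ∣ + ∣ a - t ∣ ≤ t - s → s ≤ a × a ≤ t
tight⇒between-≤ {s} {t} {a} h =
  [p-q]+[p-q]≤0⇒p≤q (begin
    (s - a) + (s - a)                  ≡⟨ solve 3 (λ s t a → (s :- a) :+ (s :- a)
                                              := ((s :- a) :+ :- (a :- t)) :- (t :- s)) refl s t a ⟩
    ((s - a) + - (a - t)) - (t - s)    ≤⟨ +-monoˡ-≤ (- (t - s))
                                              (+-mono-≤ (p≤∣p∣ (s - a)) (-p≤∣p∣ (a - t))) ⟩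
    (∣ s - a ∣ + ∣ a - t ∣) - (t - s)  ≤⟨ p≤q⇒p-q≤0 h ⟩
    0ℚ                                 ∎) ,
  [p-q]+[p-q]≤0⇒p≤q (begin
    (a - t) + (a - t)                  ≡⟨ solve 3 (λ s t a → (a :- t) :+ (a :- t)
                                              := (:- (s :- a) :+ (a :- t)) :- (t :- s)) refl s t a ⟩
    (- (s - a) + (a - t)) - (t - s)    ≤⟨ +-monoˡ-≤ (- (t - s))
                                              (+-mono-≤ (-p≤∣p∣ (s - a)) (p≤∣p∣ (a - t))) ⟩
    (∣ s - a ∣ + ∣ a - t ∣) - (t - s)  ≤⟨ p≤q⇒p-q≤0 h ⟩
    0ℚ                                 ∎)
  where open ≤-Reasoning

tight⇒between : ∀ s t a → ∣ s - a ∣ + ∣ a - t ∣ ≤ ∣ s - t ∣ → Between s t a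
tight⇒between s t a h with ≤-total s t
... | inj₁ s≤t = inj₁ (tight⇒between-≤ (subst (∣ s - a ∣ + ∣ a - t ∣ ≤_) (p≤q⇒∣p-q∣≡q-p s≤t) h))
... | inj₂ t≤s =
  inj₂ (tight⇒between-≤ (subst₂ _≤_ flip-sum (trans (∣p-q∣≡∣q-p∣ s t) (p≤q⇒∣p-q∣≡q-p t≤s)) h))
  where
  flip-sum : ∣ s - a ∣ + ∣ a - t ∣ ≡ ∣ t - a ∣ + ∣ a - s ∣
  flip-sum = trans (+-comm (∣ s - a ∣) (∣ a - t ∣))
                   (cong₂ _+_ (∣p-q∣≡∣q-p∣ a t) (∣p-q∣≡∣q-p∣ s a))

dist-self : ∀ a → dist a a ≡ 0ℚ
dist-self a rewrite +-inverseʳ (px a) | +-inverseʳ (py a) = refl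

dist-sym : ∀ a b → dist a b ≡ dist b a
dist-sym a b = cong₂ _+_ (∣p-q∣≡∣q-p∣ (px a) (px b)) (∣p-q∣≡∣q-p∣ (py a) (py b))

dist-nonneg : ∀ a b → 0ℚ ≤ dist a b
dist-nonneg a b = +-mono-≤ (0≤∣p∣ (px a - px b)) (0≤∣p∣ (py a - py b))

+-interchange : ∀ p q r s → (p + q) + (r + s) ≡ (p + r) + (q + s)
+-interchange = solve 4 (λ p q r s → (p :+ q) :+ (r :+ s) := (p :+ r) :+ (q :+ s)) refl

dist-triangle : ∀ a b c → dist a c ≤ dist a b + dist b c
dist-triangle a b c = subst (dist a c ≤_)
  (+-interchange (∣ px a - px b ∣) (∣ px b - px c ∣) (∣ py a - py b ∣) (∣ py b - py c ∣))
  (+-mono-≤ (∣p-r∣≤∣p-q∣+∣q-r∣ (px a) (px b) (px c)) (∣p-r∣≤∣p-q∣+∣q-r∣ (py a) (py b) (py c)))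

tight⇒inBox : ∀ s t a → dist s a + dist a t ≤ dist s t → InBox (s , t) a
tight⇒inBox s t a h =
  tight⇒between (px s) (px t) (px a) (proj₁ coordinates-tight) ,
  tight⇒between (py s) (py t) (py a) (proj₂ coordinates-tight)
  where
  coordinates-tight : ∣ px s - px a ∣ + ∣ px a - px t ∣ ≤ ∣ px s - px t ∣
                    × ∣ py s - py a ∣ + ∣ py a - py t ∣ ≤ ∣ py s - py t ∣
  coordinates-tight = p+q≤r+s∧r≤p∧s≤q⇒p≤r∧q≤s
    (subst (_≤ dist s t)
       (+-interchange (∣ px s - px a ∣) (∣ py s - py a ∣) (∣ px a - px t ∣) (∣ py a - py t ∣)) h)
    (∣p-r∣≤∣p-q∣+∣q-r∣ (px s) (px a) (px t))
    (∣p-r∣≤∣p-q∣+∣q-r∣ (py s) (py a) (py t))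

normEdge-cases : ∀ u w → normEdge u w ≡ (u , w) ⊎ normEdge u w ≡ (w , u)
normEdge-cases u w with px u ≟ px w
... | no _ with px u ℚ.≤? px w
...   | yes _ = inj₁ refl
...   | no _  = inj₂ refl
normEdge-cases u w | yes _ with py u ℚ.≤? py w
...   | yes _ = inj₁ refl
...   | no _  = inj₂ refl

edgeLength-normEdge : ∀ u w → edgeLength (normEdge u w) ≡ dist u w
edgeLength-normEdge u w with normEdge-cases u w
... | inj₁ eq rewrite eq = refl
... | inj₂ eq rewrite eq = dist-sym w u

edgeLength-nonneg : ∀ e → 0ℚ ≤ edgeLength e
edgeLength-nonneg (u , w) = dist-nonneg u w

normEdge-injective : ∀ {a b c d} → normEdge a b ≡ normEdge c d →
                     (a ≡ c × b ≡ d) ⊎ (a ≡ d × b ≡ c)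
normEdge-injective {a} {b} {c} {d} eq with normEdge-cases a b | normEdge-cases c d
... | inj₁ ab | inj₁ cd with trans (sym ab) (trans eq cd)
...   | refl = inj₁ (refl , refl)
normEdge-injective eq | inj₁ ab | inj₂ dc with trans (sym ab) (trans eq dc)
...   | refl = inj₂ (refl , refl)
normEdge-injective eq | inj₂ ba | inj₁ cd with trans (sym ba) (trans eq cd)
...   | refl = inj₂ (refl , refl)
normEdge-injective eq | inj₂ ba | inj₂ dc with trans (sym ba) (trans eq dc)
...   | refl = inj₁ (refl , refl)

hedge-dist-pos : ∀ {P u w} → HEdge P u w → 0ℚ < dist u w
hedge-dist-pos {u = u} {w} (_ , _ , inj₁ (_ , x<x′ , _)) =
  +-mono-<-≤ (p<q⇒0<∣p-q∣ x<x′) (0≤∣p∣ (py u - py w))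
hedge-dist-pos {u = u} {w} (_ , _ , inj₂ (_ , y<y′ , _)) =
  +-mono-≤-< (0≤∣p∣ (px u - px w)) (p<q⇒0<∣p-q∣ y<y′)

adj-dist-pos : ∀ {P u w} → Adj P u w → 0ℚ < dist u w
adj-dist-pos {P} (inj₁ uw) = hedge-dist-pos {P} uw
adj-dist-pos {P} {u} {w} (inj₂ wu) = subst (0ℚ <_) (dist-sym w u) (hedge-dist-pos {P} wu)

module _ {P : Instance} where

  dist≤walkLength : ∀ {u t} (w : Walk P u t) → dist u t ≤ walkLength w
  dist≤walkLength {u} done = ≤-reflexive (dist-self u)
  dist≤walkLength {u} {t} (step {w = v} _ r) = begin
    dist u t                                  ≤⟨ dist-triangle u v t ⟩
    dist u v + dist v t                       ≤⟨ +-monoʳ-≤ (dist u v) (dist≤walkLength r) ⟩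
    dist u v + walkLength r                   ≡⟨ cong (_+ walkLength r) (edgeLength-normEdge u v) ⟨
    edgeLength (normEdge u v) + walkLength r  ∎
    where open ≤-Reasoning

  AllSteps : (Point → Point → Set) → ∀ {u t} → Walk P u t → Set
  AllSteps R done               = ⊤
  AllSteps R (step {u} {v} _ r) = R u v × AllSteps R r

  allSteps-map : ∀ {R S : Point → Point → Set} → (∀ {a b} → R a b → S a b) →
                 ∀ {u t} (w : Walk P u t) → AllSteps R w → AllSteps S w
  allSteps-map f done       _          = _
  allSteps-map f (step _ r) (Ruv , Rr) = f Ruv , allSteps-map f r Rr

  StepEdge : (Point → Point → Set) → Edge → Set
  StepEdge R e = ∃₂ λ a b → e ≡ normEdge a b × Adj P a b × R a b

  allSteps⇒stepEdges : ∀ {R u t} (w : Walk P u t) → AllSteps R w → All (StepEdge R) (walkEdges w)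
  allSteps⇒stepEdges done                 _          = []
  allSteps⇒stepEdges (step {u} {v} adj r) (Ruv , Rr) =
    (u , v , refl , adj , Ruv) ∷ allSteps⇒stepEdges r Rr

  module _ (φ : Point → ℚ) where

    Ascending : ∀ {u t} → Walk P u t → Set
    Ascending = AllSteps (λ a b → φ a < φ b)

    EndsAbove : ℚ → Edge → Set
    EndsAbove q (a , b) = q ≤ φ a × q ≤ φ b

    normEdge-endsAbove⁺ : ∀ {q u w} → q ≤ φ u → q ≤ φ w → EndsAbove q (normEdge u w)
    normEdge-endsAbove⁺ {u = u} {w} q≤u q≤w with normEdge-cases u w
    ... | inj₁ eq rewrite eq = q≤u , q≤w
    ... | inj₂ eq rewrite eq = q≤w , q≤u

    normEdge-endsAbove⁻ : ∀ {q u w} → EndsAbove q (normEdge u w) → q ≤ φ u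
    normEdge-endsAbove⁻ {u = u} {w} above with normEdge-cases u w
    ... | inj₁ eq rewrite eq = proj₁ above
    ... | inj₂ eq rewrite eq = proj₂ above

    ascending-endsAbove : ∀ {u t} (w : Walk P u t) → Ascending w → All (EndsAbove (φ u)) (walkEdges w)
    ascending-endsAbove done                 _            = []
    ascending-endsAbove (step {u} {v} _ r) (u<v , asc) =
      normEdge-endsAbove⁺ ≤-refl (<⇒≤ u<v) ∷ All.map lower (ascending-endsAbove r asc)
      where
      lower : ∀ {e} → EndsAbove (φ v) e → EndsAbove (φ u) e
      lower (v≤a , v≤b) = ≤-trans (<⇒≤ u<v) v≤a , ≤-trans (<⇒≤ u<v) v≤b

    -- The first edge has the endpoint u, whose potential lies strictly below
    -- both endpoints of every later edge.
    ascending-walkEdges-unique : ∀ {u t} (w : Walk P u t) → Ascending w → Unique (walkEdges w)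
    ascending-walkEdges-unique done                 _            = []
    ascending-walkEdges-unique (step {u} {v} _ r) (u<v , asc) =
      All.map first-edge-new (ascending-endsAbove r asc) ∷ ascending-walkEdges-unique r asc
      where
      first-edge-new : ∀ {e} → EndsAbove (φ v) e → normEdge u v ≢ e
      first-edge-new above refl = <-irrefl refl (<-≤-trans u<v (normEdge-endsAbove⁻ above))

  GeodesicTail : Point → ∀ {u t} → Walk P u t → Set
  GeodesicTail s {u} {t} w = dist s u + walkLength w ≤ dist s t

  GeodesicStep : Point → Point → Point → Point → Set
  GeodesicStep s t a b = dist s a < dist s b × InBox (s , t) a × InBox (s , t) b

  geodesic-start-inBox : ∀ {s u t} (w : Walk P u t) → GeodesicTail s w → InBox (s , t) u
  geodesic-start-inBox {s} {u} {t} w h =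
    tight⇒inBox s t u (≤-trans (+-monoʳ-≤ (dist s u) (dist≤walkLength w)) h)

  geodesic-steps : ∀ {s u t} (w : Walk P u t) → GeodesicTail s w → AllSteps (GeodesicStep s t) w
  geodesic-steps done _ = _
  geodesic-steps {s} {u} {t} (step {w = v} adj r) h =
    (ascends , geodesic-start-inBox (step adj r) h , geodesic-start-inBox r rest) ,
    geodesic-steps r rest
    where
    open ≤-Reasoning
    L = walkLength r
    h′ : (dist s u + dist u v) + L ≤ dist s t
    h′ = subst (_≤ dist s t)
           (trans (cong (λ x → dist s u + (x + L)) (edgeLength-normEdge u v))
                  (sym (+-assoc (dist s u) (dist u v) L))) h
    rest : GeodesicTail s r
    rest = ≤-trans (+-monoˡ-≤ L (dist-triangle s u v)) h′
    ascends : dist s u < dist s v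
    ascends = begin-strict
      dist s u             ≡⟨ +-identityʳ (dist s u) ⟨
      dist s u + 0ℚ        <⟨ +-monoʳ-< (dist s u) (adj-dist-pos {P} adj) ⟩
      dist s u + dist u v  ≤⟨ p+q≤r+s∧s≤q⇒p≤r (begin
                                (dist s u + dist u v) + L  ≤⟨ h′ ⟩
                                dist s t                   ≤⟨ dist-triangle s v t ⟩
                                dist s v + dist v t        ≤⟨ +-monoʳ-≤ (dist s v) (dist≤walkLength r) ⟩
                                dist s v + L               ∎) ≤-refl ⟩
      dist s v             ∎

  Π-geodesic : ∀ {v} (π : Π P v) → AllSteps (GeodesicStep (proj₁ v) (proj₂ v)) (proj₁ π)
  Π-geodesic {s , t} (w , length≡dist) =
    geodesic-steps w (≤-reflexive (trans (cong₂ _+_ (dist-self s) length≡dist) (+-identityˡ (dist s t))))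

  BoxedEdge : Pair → Edge → Set
  BoxedEdge v = StepEdge (λ a b → InBox v a × InBox v b)

  Π-edges-boxed : ∀ {v} (π : Π P v) → All (BoxedEdge v) (walkEdges (proj₁ π))
  Π-edges-boxed π = allSteps⇒stepEdges (proj₁ π) (allSteps-map proj₂ (proj₁ π) (Π-geodesic π))

  Π-edges-unique : ∀ {v} (π : Π P v) → Unique (walkEdges (proj₁ π))
  Π-edges-unique {v} π =
    ascending-walkEdges-unique (dist (proj₁ v)) (proj₁ π) (allSteps-map proj₁ (proj₁ π) (Π-geodesic π))

  adj-share : ∀ {u v a b} → Adj P a b → InBox u a → InBox u b → InBox v a → InBox v b → ShareEdge P u v
  adj-share {a = a} {b} (inj₁ ab) ua ub va vb = a , b , ab , ua , ub , va , vb
  adj-share {a = a} {b} (inj₂ ba) ua ub va vb = b , a , ba , ub , ua , vb , va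

  boxedEdges-share : ∀ {u v e} → BoxedEdge u e → BoxedEdge v e → ShareEdge P u v
  boxedEdges-share (a , b , e≡ab , adj , ua , ub) (c , d , e≡cd , _ , vc , vd)
    with normEdge-injective {a} {b} {c} {d} (trans (sym e≡ab) e≡cd)
  ... | inj₁ (refl , refl) = adj-share adj ua ub vc vd
  ... | inj₂ (refl , refl) = adj-share adj ua ub vd vc

sumBy : {A : Set} → (A → ℚ) → List A → ℚ
sumBy f xs = sumℚ (map f xs)

module _ {A : Set} where

  sumBy-++ : ∀ (f : A → ℚ) xs ys → sumBy f (xs ++ ys) ≡ sumBy f xs + sumBy f ys
  sumBy-++ f []       ys = sym (+-identityˡ (sumBy f ys))
  sumBy-++ f (x ∷ xs) ys = trans (cong (f x +_) (sumBy-++ f xs ys)) (sym (+-assoc (f x) _ _))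

  sumBy-concatMap : ∀ {B : Set} (f : A → ℚ) (g : B → List A) xs →
                    sumBy f (concatMap g xs) ≡ sumBy (sumBy f ∘ g) xs
  sumBy-concatMap f g []       = refl
  sumBy-concatMap f g (x ∷ xs) =
    trans (sumBy-++ f (g x) (concatMap g xs)) (cong (sumBy f (g x) +_) (sumBy-concatMap f g xs))

  sumBy-cong : ∀ {f g : A → ℚ} → (∀ x → f x ≡ g x) → ∀ xs → sumBy f xs ≡ sumBy g xs
  sumBy-cong f≡g []       = refl
  sumBy-cong f≡g (x ∷ xs) = cong₂ _+_ (f≡g x) (sumBy-cong f≡g xs)

  sumBy-filter : ∀ (f : A → ℚ) {Q : A → Set} (Q? : ∀ x → Dec (Q x)) xs →
                 sumBy f xs ≡ sumBy f (filter Q? xs) + sumBy f (filter (¬? ∘ Q?) xs)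
  sumBy-filter f Q? []       = sym (+-identityˡ 0ℚ)
  sumBy-filter f Q? (x ∷ xs) with Q? x
  ... | yes _ = trans (cong (f x +_) (sumBy-filter f Q? xs)) (sym (+-assoc (f x) _ _))
  ... | no  _ = trans (cong (f x +_) (sumBy-filter f Q? xs))
                      (solve 3 (λ a b c → a :+ (b :+ c) := b :+ (a :+ c)) refl
                             (f x) (sumBy f (filter Q? xs)) (sumBy f (filter (¬? ∘ Q?) xs)))

  module _ (f : A → ℚ) (f≥0 : ∀ x → 0ℚ ≤ f x) where

    sumBy-unique-≡-≤ : ∀ {y xs} → Unique xs → All (_≡ y) xs → sumBy f xs ≤ f y
    sumBy-unique-≡-≤ {y} []               []                = f≥0 y
    sumBy-unique-≡-≤ {y} (_ ∷ [])         (refl ∷ [])       = ≤-reflexive (+-identityʳ (f y))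
    sumBy-unique-≡-≤     ((x≢x′ ∷ _) ∷ _) (refl ∷ refl ∷ _) = ⊥-elim (x≢x′ refl)

    sumBy-mono-⊆ : DecidableEquality A → ∀ {xs} ys → Unique xs → xs ⊆ ys → sumBy f xs ≤ sumBy f ys
    sumBy-mono-⊆ _≟_ {[]}    []       _   _    = ≤-refl
    sumBy-mono-⊆ _≟_ {_ ∷ _} []       _   xs⊆[] with () ← xs⊆[] (here refl)
    sumBy-mono-⊆ _≟_ {xs}    (y ∷ ys) xs! xs⊆ = begin
      sumBy f xs                                                  ≡⟨ sumBy-filter f (_≟ y) xs ⟩
      sumBy f (filter (_≟ y) xs) + sumBy f (filter (¬? ∘ (_≟ y)) xs)
        ≤⟨ +-mono-≤ (sumBy-unique-≡-≤ (Uniqueₚ.filter⁺ (_≟ y) xs!) (Allₚ.all-filter (_≟ y) xs))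
                    (sumBy-mono-⊆ _≟_ ys (Uniqueₚ.filter⁺ (¬? ∘ (_≟ y)) xs!) others⊆ys) ⟩
      f y + sumBy f ys                                            ∎
      where
      open ≤-Reasoning
      others⊆ys : filter (¬? ∘ (_≟ y)) xs ⊆ ys
      others⊆ys x∈ with ∈-filter⁻ (¬? ∘ (_≟ y)) x∈
      ... | x∈xs , x≢y with xs⊆ x∈xs
      ...   | here x≡y = ⊥-elim (x≢y x≡y)
      ...   | there x∈ys = x∈ys

  sumBy-lookup : ∀ (f : A → ℚ) xs → sumBy (f ∘ lookup xs) (allFin (length xs)) ≡ sumBy f xs
  sumBy-lookup f xs = cong sumℚ (begin
    map (f ∘ lookup xs) (allFin (length xs))  ≡⟨ map-tabulate id (f ∘ lookup xs) ⟩
    tabulate (f ∘ lookup xs)                  ≡⟨ map-tabulate (lookup xs) f ⟨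
    map f (tabulate (lookup xs))              ≡⟨ cong (map f) (tabulate-lookup xs) ⟩
    map f xs                                  ∎)
    where open ≡-Reasoning

ℕtoℚ-suc : ∀ k → ℕtoℚ (suc k) ≡ 1ℚ + ℕtoℚ k
ℕtoℚ-suc k = begin
  ℕtoℚ (suc k)   ≡⟨ ℕtoℚ≡ι (suc k) ⟩
  ι (suc k)      ≡⟨ toℚᵘ-injective (ℚᵘ.≃-sym (ℚᵘ.≃-trans (toℚᵘ-homo-+ 1ℚ (ι k))
                      (*≡* (cong (λ z → (ℤ.+ 1 ℤ.+ z) ℤ.* ℤ.+ 1) (ℤ.*-identityʳ (ℤ.+ k)))))) ⟩
  1ℚ + ι k       ≡⟨ cong (1ℚ +_) (ℕtoℚ≡ι k) ⟨
  1ℚ + ℕtoℚ k    ∎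
  where
  open ≡-Reasoning
  ι : ℕ → ℚ
  ι n = mkℚ (ℤ.+ n) 0 (coprime-sym (1-coprimeTo n))
  ℕtoℚ≡ι : ∀ n → ℕtoℚ n ≡ ι n
  ℕtoℚ≡ι n = normalize-coprime (coprime-sym (1-coprimeTo n))

module _ {A : Set} (f : A → ℚ) (colour : A → ℕ) {M : ℚ}
         (class-bound : ∀ c {xs} → Unique xs → All (λ x → colour x ≡ c) xs → sumBy f xs ≤ M) where

  sumBy-≤-colours : ∀ k {xs} → Unique xs → All (λ x → colour x ℕ.< k) xs → sumBy f xs ≤ ℕtoℚ k * M
  sumBy-≤-colours zero    {[]} _   []    = ≤-reflexive (sym (*-zeroˡ M))
  sumBy-≤-colours (suc k) {xs} xs! <k+1 = begin
    sumBy f xs                                                  ≡⟨ sumBy-filter f has-k xs ⟩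
    sumBy f (filter has-k xs) + sumBy f (filter (¬? ∘ has-k) xs)
      ≤⟨ +-mono-≤ (class-bound k (Uniqueₚ.filter⁺ has-k xs!) (Allₚ.all-filter has-k xs))
                  (sumBy-≤-colours k (Uniqueₚ.filter⁺ (¬? ∘ has-k) xs!) others<k) ⟩
    M + ℕtoℚ k * M                                              ≡⟨ cong (_+ ℕtoℚ k * M) (*-identityˡ M) ⟨
    1ℚ * M + ℕtoℚ k * M                                         ≡⟨ *-distribʳ-+ M 1ℚ (ℕtoℚ k) ⟨
    (1ℚ + ℕtoℚ k) * M                                           ≡⟨ cong (_* M) (ℕtoℚ-suc k) ⟨
    ℕtoℚ (suc k) * M                                            ∎
    where
    open ≤-Reasoning
    has-k = λ x → colour x ℕ.≟ k
    others<k : All (λ x → colour x ℕ.< k) (filter (¬? ∘ has-k) xs)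
    others<k = All.zipWith (λ (<k+1 , ≢k) → ℕ.≤∧≢⇒< (ℕ.≤-pred <k+1) ≢k)
                 (Allₚ.filter⁺ (¬? ∘ has-k) <k+1 , Allₚ.all-filter (¬? ∘ has-k) xs)

pairDist : Pair → ℚ
pairDist v = dist (proj₁ v) (proj₂ v)

module _ {P : Instance} where

  feasEdges-sum : ∀ {Q} (ns : All (Π P) Q) → sumBy edgeLength (feasEdges ns) ≡ sumBy pairDist Q
  feasEdges-sum []                       = refl
  feasEdges-sum ((w , length≡dist) ∷ ns) =
    trans (sumBy-++ edgeLength (walkEdges w) (feasEdges ns)) (cong₂ _+_ length≡dist (feasEdges-sum ns))

  feasEdges-⊇ : ∀ {Q v} (ns : All (Π P) Q) (v∈Q : v ∈ Q) →
                walkEdges (proj₁ (All.lookup ns v∈Q)) ⊆ feasEdges ns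
  feasEdges-⊇ ((w , _) ∷ ns) (here refl) = ∈-++⁺ˡ
  feasEdges-⊇ ((w , _) ∷ ns) (there v∈Q) = ∈-++⁺ʳ (walkEdges w) ∘ feasEdges-⊇ ns v∈Q

  ‖‖≤sumBy-feasEdges : (N : Feas P) → ‖ N ‖ ≤ sumBy edgeLength (feasEdges N)
  ‖‖≤sumBy-feasEdges N = sumBy-mono-⊆ edgeLength edgeLength-nonneg _≟E_ (feasEdges N)
    (deduplicate-! (feasEdges N)) (∈-deduplicate⁻ _≟E_ (feasEdges N))

module _ {P : Instance} (N* : Feas P) {k : ℕ} (col : Fin (length P) → Fin k)
         (proper : ∀ i j → IGAdj P i j → col i ≢ col j) where

  path : (i : Fin (length P)) → Π P (lookup P i)
  path i = All.lookup N* (∈-lookup i)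

  pathEdges : Fin (length P) → List Edge
  pathEdges i = walkEdges (proj₁ (path i))

  same-colour-disjoint : ∀ {i j} → i ≢ j → col i ≡ col j → Disjoint (pathEdges i) (pathEdges j)
  same-colour-disjoint {i} {j} i≢j same (e∈i , e∈j) = proper i j
    (i≢j , boxedEdges-share {P} (All.lookup (Π-edges-boxed (path i)) e∈i)
                                (All.lookup (Π-edges-boxed (path j)) e∈j))
    same

  colour-class-disjoint : ∀ {c is} → Unique is → All (λ i → toℕ (col i) ≡ c) is →
                          AllPairs (λ i j → Disjoint (pathEdges i) (pathEdges j)) is
  colour-class-disjoint           []           []         = []
  colour-class-disjoint {is = i ∷ _} (i≢is ∷ is!) (ci ∷ cis) =
    All.zipWith {R = λ j → Disjoint (pathEdges i) (pathEdges j)}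
      (λ (i≢j , cj) → same-colour-disjoint i≢j (toℕ-injective (trans ci (sym cj)))) (i≢is , cis)
    ∷ colour-class-disjoint is! cis

  colour-class-bound : ∀ c {is} → Unique is → All (λ i → toℕ (col i) ≡ c) is →
                       sumBy (pairDist ∘ lookup P) is ≤ ‖ N* ‖
  colour-class-bound c {is} is! same = begin
    sumBy (pairDist ∘ lookup P) is             ≡⟨ sumBy-cong (λ i → proj₂ (path i)) is ⟨
    sumBy (sumBy edgeLength ∘ pathEdges) is    ≡⟨ sumBy-concatMap edgeLength pathEdges is ⟨
    sumBy edgeLength (concatMap pathEdges is)  ≤⟨ sumBy-mono-⊆ edgeLength edgeLength-nonneg _≟E_ _
                                                     class-edges! class-edges⊆ ⟩
    ‖ N* ‖                                     ∎
    where
    open ≤-Reasoning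
    class-edges! : Unique (concatMap pathEdges is)
    class-edges! = Uniqueₚ.concat⁺ (Allₚ.map⁺ (All.universal (Π-edges-unique ∘ path) is))
                                   (AllPairsₚ.map⁺ (colour-class-disjoint is! same))
    class-edges⊆ : concatMap pathEdges is ⊆ deduplicate _≟E_ (feasEdges N*)
    class-edges⊆ e∈ with satisfied (∈-concatMap⁻ pathEdges {xs = is} e∈)
    ... | i , e∈i = ∈-deduplicate⁺ _≟E_ (feasEdges-⊇ N* (∈-lookup i) e∈i)

proposition2 : (P : Instance) → Unique P → (k : ℕ) → Colorable P k →
    (N* : Feas P) → IsOpt P N* →
    (N : Feas P) → ‖ N ‖ ≤ ℕtoℚ k * ‖ N* ‖
proposition2 P _ k (col , proper) N* _ N = begin
  ‖ N ‖                                            ≤⟨ ‖‖≤sumBy-feasEdges N ⟩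
  sumBy edgeLength (feasEdges N)                   ≡⟨ feasEdges-sum N ⟩
  sumBy pairDist P                                 ≡⟨ sumBy-lookup pairDist P ⟨
  sumBy (pairDist ∘ lookup P) (allFin (length P))  ≤⟨ sumBy-≤-colours (pairDist ∘ lookup P) (toℕ ∘ col)
                                                        (colour-class-bound N* col proper) k
                                                        (Uniqueₚ.allFin⁺ (length P))
                                                        (All.universal (toℕ<n ∘ col) _) ⟩
  ℕtoℚ k * ‖ N* ‖                                  ∎
  where open ≤-Reasoning
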